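{- For $k\ge 3$ and $n\ge 1$, the set $\mathscr{G}_n(k12\cdots(k-1))$ is in one-to-one correspondence with the set of Grassmannian Dyck paths of semilength $n$ having at most $k-2$ peaks at height greater than $1$.
   Context: A permutation is Grassmannian if it has at most one descent (a position $i$ with $\pi(i)>\pi(i+1)$); $\mathscr{G}_n(\sigma)$ is the set of Grassmannian permutations of $[n]$ avoiding the classical pattern $\sigma$. A Dyck path of semilength $n$ is a lattice path from $(0,0)$ to $(2n,0)$ with steps $\mathsf{U}=(1,1)$, $\mathsf{D}=(1,-1)$ never going below the $x$-axis; a peak is an occurrence of $\mathsf{U}\mathsf{D}$, and its height is the $y$-coordinate of its top point. A long ascent is a maximal run of at least two consecutive $\mathsf{U}$ steps. A Grassmannian Dyck path is a Dyck path having at most one long ascent. -}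

module Defs where

open import Data.Nat using (ℕ; zero; suc; _+_; _∸_; _≤ᵇ_; _<ᵇ_; _≡ᵇ_)
open import Data.Bool using (Bool; true; false; _∧_; _∨_; not; if_then_else_)
open import Data.List using (List; []; _∷_; length; map; upTo)
open import Data.Bool.ListAction using (all; any)
open import Data.Product using (Σ; _×_)
open import Data.Unit using (⊤)
open import Data.Bool using (T)

-- Permutations of [n] in one-line notation: lists π(1) … π(n)

elemᵇ : ℕ → List ℕ → Bool
elemᵇ x []       = false
elemᵇ x (y ∷ ys) = (x ≡ᵇ y) ∨ elemᵇ x ys

distinctᵇ : List ℕ → Bool
distinctᵇ []       = true
distinctᵇ (x ∷ xs) = not (elemᵇ x xs) ∧ distinctᵇ xs

isPermᵇ : ℕ → List ℕ → Bool
isPermᵇ n π = (length π ≡ᵇ n) ∧ all (λ x → (1 ≤ᵇ x) ∧ (x ≤ᵇ n)) π ∧ distinctᵇ π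

descents : List ℕ → ℕ
descents []           = 0
descents (x ∷ [])     = 0
descents (x ∷ y ∷ xs) = (if y <ᵇ x then 1 else 0) + descents (y ∷ xs)

isGrassmannianᵇ : List ℕ → Bool
isGrassmannianᵇ π = descents π ≤ᵇ 1

subseqs : ℕ → List ℕ → List (List ℕ)
subseqs zero    xs       = [] ∷ []
subseqs (suc m) []       = []
subseqs (suc m) (x ∷ xs) = map (x ∷_) (subseqs m xs) Data.List.++ subseqs (suc m) xs

lookupᵇ : List ℕ → ℕ → ℕ
lookupᵇ []       _       = 0
lookupᵇ (x ∷ xs) zero    = x
lookupᵇ (x ∷ xs) (suc i) = lookupᵇ xs i

orderIsoᵇ : List ℕ → List ℕ → Bool
orderIsoᵇ τ σ =
  (length τ ≡ᵇ length σ) ∧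
  all (λ i → all (λ j →
         ((lookupᵇ τ i <ᵇ lookupᵇ τ j) ∧ (lookupᵇ σ i <ᵇ lookupᵇ σ j))
       ∨ (not (lookupᵇ τ i <ᵇ lookupᵇ τ j) ∧ not (lookupᵇ σ i <ᵇ lookupᵇ σ j)))
       (upTo (length σ)))
      (upTo (length σ))

containsᵇ : List ℕ → List ℕ → Bool
containsᵇ σ π = any (λ τ → orderIsoᵇ τ σ) (subseqs (length σ) π)

avoidsᵇ : List ℕ → List ℕ → Bool
avoidsᵇ σ π = not (containsᵇ σ π)

pat : ℕ → List ℕ
pat k = k ∷ map suc (upTo (k ∸ 1))

𝒢 : ℕ → List ℕ → Set
𝒢 n σ = Σ (List ℕ) (λ π → T (isPermᵇ n π ∧ isGrassmannianᵇ π ∧ avoidsᵇ σ π))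

data Step : Set where
  U D : Step

dyckFromᵇ : ℕ → List Step → Bool
dyckFromᵇ zero    []      = true
dyckFromᵇ (suc h) []      = false
dyckFromᵇ h       (U ∷ r) = dyckFromᵇ (suc h) r
dyckFromᵇ zero    (D ∷ r) = false
dyckFromᵇ (suc h) (D ∷ r) = dyckFromᵇ h r

isDyckᵇ : ℕ → List Step → Bool
isDyckᵇ n p = (length p ≡ᵇ (n + n)) ∧ dyckFromᵇ 0 p

highPeaksFrom : ℕ → List Step → ℕ
highPeaksFrom h []          = 0
highPeaksFrom h (U ∷ D ∷ r) = (if 1 <ᵇ suc h then 1 else 0) + highPeaksFrom (suc h) (D ∷ r)
highPeaksFrom h (U ∷ r)     = highPeaksFrom (suc h) r
highPeaksFrom h (D ∷ r)     = highPeaksFrom (h ∸ 1) r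

highPeaks : List Step → ℕ
highPeaks = highPeaksFrom 0

mutual
  longAscents : List Step → ℕ
  longAscents []          = 0
  longAscents (U ∷ U ∷ r) = suc (skipU r)
  longAscents (U ∷ r)     = longAscents r
  longAscents (D ∷ r)     = longAscents r

  skipU : List Step → ℕ
  skipU (U ∷ r) = skipU r
  skipU r       = longAscents r

isGrassmannianDyckᵇ : ℕ → List Step → Bool
isGrassmannianDyckᵇ n p = isDyckᵇ n p ∧ (longAscents p ≤ᵇ 1)

GDyck : ℕ → ℕ → Set
GDyck n m = Σ (List Step) (λ p → T (isGrassmannianDyckᵇ n p ∧ (highPeaks p ≤ᵇ m)))

{-# OPTIONS --safe #-}
module Submission where

-- A Grassmannian permutation of [n] is A ++ B with A and B increasing; record it by the word w whose
-- i-th letter says whether i ∈ A, made unique by asking that the first letter false be followed by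
-- some true (so that a descent really occurs).  An occurrence of k 1 2 ⋯ (k-1) must take k from A and
-- the rest from B below it, so the permutation avoids the pattern iff at most k-2 letters false are
-- followed by a true ("covered").  The same words encode Grassmannian Dyck paths: leading trues are
-- low peaks U D, the first false is the unique long ascent U^(1+t) D with t ≥ 1 the number of later
-- trues, and after it true ↦ D, false ↦ U D.  A false is a peak of height > 1 exactly when it is
-- covered, so both sets are in bijection with the canonical words of length n having at most k-2
-- covered falses.

open import Data.Bool using (Bool; true; false; _∧_; _∨_; not; if_then_else_; T)
open import Data.Bool.ListAction using (all)
open import Data.Bool.Properties using (T-∧; T-∨; T-≡; T-irrelevant)
open import Data.Empty using (⊥-elim)
open import Data.List using (List; []; _∷_; _++_; length; map; applyUpTo; filter; take)
open import Data.List.Membership.Propositional using (_∈_; _∉_; find; lose)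
open import Data.List.Membership.Propositional.Properties using (∈-++⁻; ∈-++⁺ˡ; ∈-++⁺ʳ; ∈-map⁻; ∈-map⁺)
open import Data.List.Properties
  using (length-map; length-take; filter-none; filter-accept; filter-all; ∷-injective; ∷-injectiveˡ; ∷-injectiveʳ)
open import Data.List.Relation.Binary.Disjoint.Propositional using (Disjoint)
open import Data.List.Relation.Binary.Permutation.Propositional using (_↭_; ↭-refl; ↭-sym; ↭-trans; prep; ↭⇒↭ₛ)
open import Data.List.Relation.Binary.Permutation.Propositional.Properties using (shift; ↭-length; All-resp-↭)
open import Data.List.Relation.Binary.Sublist.Propositional using (_⊆_; []; _∷_; _∷ʳ_; minimum; from∈; ⊆-trans)
open import Data.List.Relation.Binary.Sublist.Propositional.Properties
  using (All-resp-⊆; take-⊆; filter-⊆; filter⁺; length-mono-≤; ++⁺)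
open import Data.List.Relation.Unary.All as All using (All; []; _∷_)
import Data.List.Relation.Unary.All.Properties as All
open import Data.List.Relation.Unary.AllPairs using ([]; _∷_)
open import Data.List.Relation.Unary.Any using (Any; here; there)
import Data.List.Relation.Unary.Any.Properties as Any
open import Data.List.Relation.Unary.Unique.Propositional using (Unique)
open import Data.Nat using (ℕ; zero; suc; _+_; _∸_; _≡ᵇ_; _≤ᵇ_; _<ᵇ_; _<?_; _≤_; _<_; z≤n; s≤s; z<s)
open import Data.Nat.Properties
open import Data.Product using (Σ; _×_; _,_; proj₁; proj₂)
open import Data.Sum using (inj₁; inj₂)
open import Data.Unit using (⊤)
open import Function using (_∘_; id)
open import Function.Bundles using (_↔_; mk↔ₛ′; Equivalence)
open import Function.Properties.Inverse using (↔-sym; ↔-trans)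
open import Relation.Binary.PropositionalEquality
open import Relation.Nullary using (¬_; contradiction; ofʸ; ofⁿ)
open import Relation.Nullary.Irrelevant using (Irrelevant)
open import Data.List.Relation.Binary.Permutation.Setoid.Properties (setoid ℕ) using (Unique-resp-↭)

open import Defs

T-∧⁺ : ∀ {a b} → T a → T b → T (a ∧ b)
T-∧⁺ p q = Equivalence.from T-∧ (p , q)

T-∧⁻ : ∀ {a b} → T (a ∧ b) → T a × T b
T-∧⁻ = Equivalence.to T-∧

T-not⁺ : ∀ {b} → ¬ T b → T (not b)
T-not⁺ {false} _  = _
T-not⁺ {true}  ¬t = ¬t _

T-not⁻ : ∀ {b} → T (not b) → ¬ T b
T-not⁻ {false} _ ()

<ᵇ-true : ∀ {x y} → x < y → (x <ᵇ y) ≡ true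
<ᵇ-true x<y = Equivalence.to T-≡ (<⇒<ᵇ x<y)

<ᵇ-false : ∀ {x y} → y ≤ x → (x <ᵇ y) ≡ false
<ᵇ-false {x} {y} y≤x with x <ᵇ y | <ᵇ-reflects-< x y
... | false | _       = refl
... | true  | ofʸ x<y = contradiction y≤x (<⇒≱ x<y)

m+m≡n+n⇒m≡n : ∀ {m n} → m + m ≡ n + n → m ≡ n
m+m≡n+n⇒m≡n {zero}  {zero}  _ = refl
m+m≡n+n⇒m≡n {suc m} {suc n} e = cong suc (m+m≡n+n⇒m≡n (suc-injective (begin
  suc (m + m)  ≡⟨ +-suc m m ⟨
  m + suc m    ≡⟨ suc-injective e ⟩
  n + suc n    ≡⟨ +-suc n n ⟩
  suc (n + n)  ∎)))
  where open ≡-Reasoning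

Any⇒1≤length : ∀ {P : ℕ → Set} {xs} → Any P xs → 1 ≤ length xs
Any⇒1≤length {xs = _ ∷ _} _ = s≤s z≤n

Unique-++⇒Disjoint : ∀ (A : List ℕ) {B} → Unique (A ++ B) → Disjoint A B
Unique-++⇒Disjoint (a ∷ A) (a∉ ∷ _) (here refl , a∈B)  = All.lookup (All.++⁻ʳ A a∉) a∈B refl
Unique-++⇒Disjoint (a ∷ A) (_ ∷ u)  (there x∈A , x∈B) = Unique-++⇒Disjoint A u (x∈A , x∈B)

Σ-≡-irrelevant : {A : Set} {B : A → Set} → (∀ {a} → Irrelevant (B a)) →
                 {u v : Σ A B} → proj₁ u ≡ proj₁ v → u ≡ v
Σ-≡-irrelevant irr {a , p} {.a , q} refl = cong (a ,_) (irr p q)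

module _ {A X : Set} {Q : A → Set} (P : X → Bool) (f : A → X)
         (Q-irrelevant : ∀ {a} → Irrelevant (Q a))
         (f-sound : ∀ {a} → Q a → T (P (f a)))
         (f-injective : ∀ {a b} → Q a → Q b → f a ≡ f b → a ≡ b)
         (f-onto : ∀ x → T (P x) → Σ A λ a → Q a × f a ≡ x)
         where

  ↔-image : Σ A Q ↔ Σ X (λ x → T (P x))
  ↔-image = mk↔ₛ′ to from to∘from from∘to
    where
    to : Σ A Q → Σ X (λ x → T (P x))
    to (a , q) = f a , f-sound q

    from : Σ X (λ x → T (P x)) → Σ A Q
    from (x , p) = let (a , q , _) = f-onto x p in a , q

    to∘from : ∀ y → to (from y) ≡ y
    to∘from (x , p) = Σ-≡-irrelevant T-irrelevant (proj₂ (proj₂ (f-onto x p)))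

    from∘to : ∀ u → from (to u) ≡ u
    from∘to (a , q) =
      let (_ , q′ , fa′≡fa) = f-onto (f a) (f-sound q)
      in Σ-≡-irrelevant Q-irrelevant (f-injective q′ q fa′≡fa)

countTrue : List Bool → ℕ
countTrue []          = 0
countTrue (true ∷ w)  = suc (countTrue w)
countTrue (false ∷ w) = countTrue w

-- A letter false is covered if some letter true follows it; the test is phrased as in highPeaksFrom.
coveredFalses : List Bool → ℕ
coveredFalses []          = 0
coveredFalses (true ∷ w)  = coveredFalses w
coveredFalses (false ∷ w) = (if 1 <ᵇ suc (countTrue w) then 1 else 0) + coveredFalses w

coveredFalses-false : ∀ w → 1 ≤ countTrue w → coveredFalses (false ∷ w) ≡ suc (coveredFalses w)
coveredFalses-false w 1≤t with countTrue w
... | suc _ = refl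

countTrue≡0⇒coveredFalses≡0 : ∀ w → countTrue w ≡ 0 → coveredFalses w ≡ 0
countTrue≡0⇒coveredFalses≡0 []          _  = refl
countTrue≡0⇒coveredFalses≡0 (false ∷ w) t≡0 rewrite t≡0 = countTrue≡0⇒coveredFalses≡0 w t≡0

1≤coveredFalses⇒1≤countTrue : ∀ w → 1 ≤ coveredFalses w → 1 ≤ countTrue w
1≤coveredFalses⇒1≤countTrue w 1≤cf =
  n≢0⇒n>0 λ t≡0 → contradiction (subst (1 ≤_) (countTrue≡0⇒coveredFalses≡0 w t≡0) 1≤cf) λ ()

data Canonical : List Bool → Set where
  canonical-[]    : Canonical []
  canonical-true  : ∀ {w} → Canonical w → Canonical (true ∷ w)
  canonical-false : ∀ {w} → 1 ≤ countTrue w → Canonical (false ∷ w)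

Canonical-irrelevant : ∀ {w} → Irrelevant (Canonical w)
Canonical-irrelevant canonical-[]        canonical-[]         = refl
Canonical-irrelevant (canonical-true c)  (canonical-true c′)  = cong canonical-true (Canonical-irrelevant c c′)
Canonical-irrelevant (canonical-false p) (canonical-false p′) = cong canonical-false (≤-irrelevant p p′)

IsWord : ℕ → ℕ → List Bool → Set
IsWord n m w = Canonical w × length w ≡ n × coveredFalses w ≤ m

Words : ℕ → ℕ → Set
Words n m = Σ (List Bool) (IsWord n m)

IsWord-irrelevant : ∀ {n m w} → Irrelevant (IsWord n m w)
IsWord-irrelevant (c , l , b) (c′ , l′ , b′)
  rewrite Canonical-irrelevant c c′ | ≡-irrelevant l l′ | ≤-irrelevant b b′ = refl

ups : ℕ → List Step → List Step
ups zero    r = r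
ups (suc j) r = U ∷ ups j r

shortAscentPath : List Bool → List Step
shortAscentPath []          = []
shortAscentPath (true ∷ v)  = D ∷ shortAscentPath v
shortAscentPath (false ∷ v) = U ∷ D ∷ shortAscentPath v

toDyck : List Bool → List Step
toDyck []          = []
toDyck (true ∷ w)  = U ∷ D ∷ toDyck w
toDyck (false ∷ v) = ups (suc (countTrue v)) (D ∷ shortAscentPath v)

dyckFromᵇ-U : ∀ h r → dyckFromᵇ h (U ∷ r) ≡ dyckFromᵇ (suc h) r
dyckFromᵇ-U zero    r = refl
dyckFromᵇ-U (suc h) r = refl

dyckFromᵇ-ups : ∀ h j r → dyckFromᵇ h (ups j r) ≡ dyckFromᵇ (j + h) r
dyckFromᵇ-ups h zero    r = refl
dyckFromᵇ-ups h (suc j) r = begin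
  dyckFromᵇ h (U ∷ ups j r)    ≡⟨ dyckFromᵇ-U h (ups j r) ⟩
  dyckFromᵇ (suc h) (ups j r)  ≡⟨ dyckFromᵇ-ups (suc h) j r ⟩
  dyckFromᵇ (j + suc h) r      ≡⟨ cong (λ x → dyckFromᵇ x r) (+-suc j h) ⟩
  dyckFromᵇ (suc j + h) r      ∎
  where open ≡-Reasoning

shortAscentPath-dyck : ∀ v → T (dyckFromᵇ (countTrue v) (shortAscentPath v))
shortAscentPath-dyck []          = _
shortAscentPath-dyck (true ∷ v)  = shortAscentPath-dyck v
shortAscentPath-dyck (false ∷ v) =
  subst T (sym (dyckFromᵇ-U (countTrue v) _)) (shortAscentPath-dyck v)

toDyck-dyck : ∀ w → T (dyckFromᵇ 0 (toDyck w))
toDyck-dyck []          = _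
toDyck-dyck (true ∷ w)  = toDyck-dyck w
toDyck-dyck (false ∷ v)
  rewrite dyckFromᵇ-ups 0 (suc (countTrue v)) (D ∷ shortAscentPath v)
        | +-identityʳ (countTrue v) = shortAscentPath-dyck v

length-ups : ∀ j r → length (ups j r) ≡ j + length r
length-ups zero    r = refl
length-ups (suc j) r = cong suc (length-ups j r)

length-shortAscentPath : ∀ v → length (shortAscentPath v) + countTrue v ≡ length v + length v
length-shortAscentPath []          = refl
length-shortAscentPath (true ∷ v)  = cong suc (begin
  length (shortAscentPath v) + suc (countTrue v)  ≡⟨ +-suc _ (countTrue v) ⟩
  suc (length (shortAscentPath v) + countTrue v)  ≡⟨ cong suc (length-shortAscentPath v) ⟩
  suc (length v + length v)                       ≡⟨ +-suc (length v) (length v) ⟨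
  length v + suc (length v)                       ∎)
  where open ≡-Reasoning
length-shortAscentPath (false ∷ v) = cong suc (begin
  suc (length (shortAscentPath v) + countTrue v)  ≡⟨ cong suc (length-shortAscentPath v) ⟩
  suc (length v + length v)                       ≡⟨ +-suc (length v) (length v) ⟨
  length v + suc (length v)                       ∎)
  where open ≡-Reasoning

length-toDyck : ∀ w → length (toDyck w) ≡ length w + length w
length-toDyck []          = refl
length-toDyck (true ∷ w)  = cong suc (begin
  suc (length (toDyck w))    ≡⟨ cong suc (length-toDyck w) ⟩
  suc (length w + length w)  ≡⟨ +-suc (length w) (length w) ⟨
  length w + suc (length w)  ∎)
  where open ≡-Reasoning
length-toDyck (false ∷ v) = cong suc (begin
  length (ups t (D ∷ shortAscentPath v))  ≡⟨ length-ups t _ ⟩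
  t + suc (length (shortAscentPath v))    ≡⟨ +-suc t _ ⟩
  suc (t + length (shortAscentPath v))    ≡⟨ cong suc (+-comm t _) ⟩
  suc (length (shortAscentPath v) + t)    ≡⟨ cong suc (length-shortAscentPath v) ⟩
  suc (length v + length v)               ≡⟨ +-suc (length v) (length v) ⟨
  length v + suc (length v)               ∎)
  where
  t : ℕ
  t = countTrue v
  open ≡-Reasoning

longAscents-shortAscentPath : ∀ v → longAscents (shortAscentPath v) ≡ 0
longAscents-shortAscentPath []          = refl
longAscents-shortAscentPath (true ∷ v)  = longAscents-shortAscentPath v
longAscents-shortAscentPath (false ∷ v) = longAscents-shortAscentPath v

skipU-ups : ∀ j r → skipU (ups j (D ∷ r)) ≡ longAscents r
skipU-ups zero    r = refl
skipU-ups (suc j) r = skipU-ups j r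

longAscents-toDyck : ∀ w → longAscents (toDyck w) ≤ 1
longAscents-toDyck []          = z≤n
longAscents-toDyck (true ∷ w)  = longAscents-toDyck w
longAscents-toDyck (false ∷ v) with countTrue v
... | zero  = subst (_≤ 1) (sym (longAscents-shortAscentPath v)) z≤n
... | suc t = s≤s (≤-reflexive (trans (skipU-ups t _) (longAscents-shortAscentPath v)))

highPeaksFrom-ups : ∀ h t r → highPeaksFrom h (ups (suc t) (D ∷ r))
                    ≡ (if 1 <ᵇ suc (t + h) then 1 else 0) + highPeaksFrom (t + h) r
highPeaksFrom-ups h zero    r = refl
highPeaksFrom-ups h (suc t) r =
  trans (highPeaksFrom-ups (suc h) t r)
        (cong (λ x → (if 1 <ᵇ suc x then 1 else 0) + highPeaksFrom x r) (+-suc t h))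

highPeaksFrom-shortAscentPath : ∀ v → highPeaksFrom (countTrue v) (shortAscentPath v) ≡ coveredFalses v
highPeaksFrom-shortAscentPath []          = refl
highPeaksFrom-shortAscentPath (true ∷ v)  = highPeaksFrom-shortAscentPath v
highPeaksFrom-shortAscentPath (false ∷ v) =
  cong ((if 1 <ᵇ suc (countTrue v) then 1 else 0) +_) (highPeaksFrom-shortAscentPath v)

highPeaks-toDyck : ∀ w → highPeaks (toDyck w) ≡ coveredFalses w
highPeaks-toDyck []          = refl
highPeaks-toDyck (true ∷ w)  = highPeaks-toDyck w
highPeaks-toDyck (false ∷ v)
  rewrite highPeaksFrom-ups 0 (countTrue v) (shortAscentPath v)
        | +-identityʳ (countTrue v) =
  cong ((if 1 <ᵇ suc (countTrue v) then 1 else 0) +_) (highPeaksFrom-shortAscentPath v)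

shortAscentPath-onto : ∀ r h → longAscents r ≡ 0 → T (dyckFromᵇ h r) →
                       Σ (List Bool) λ v → countTrue v ≡ h × shortAscentPath v ≡ r
shortAscentPath-onto []          zero    _  _  = [] , refl , refl
shortAscentPath-onto (D ∷ r)     (suc h) la dk =
  let (v , t≡h , path≡r) = shortAscentPath-onto r h la dk
  in true ∷ v , cong suc t≡h , cong (D ∷_) path≡r
shortAscentPath-onto (U ∷ D ∷ r) h       la dk =
  let (v , t≡h , path≡r) = shortAscentPath-onto r h la (subst T (dyckFromᵇ-U h (D ∷ r)) dk)
  in false ∷ v , t≡h , cong (λ x → U ∷ D ∷ x) path≡r
shortAscentPath-onto (U ∷ U ∷ r) h       () _
shortAscentPath-onto (U ∷ [])    zero    _  ()
shortAscentPath-onto (U ∷ [])    (suc h) _  ()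

ups-D-split : ∀ r h → T (dyckFromᵇ (suc h) r) → Σ ℕ λ j → Σ (List Step) λ r′ → ups j (D ∷ r′) ≡ r
ups-D-split (D ∷ r) h _  = 0 , r , refl
ups-D-split (U ∷ r) h dk = let (j , r′ , e) = ups-D-split r (suc h) dk in suc j , r′ , cong (U ∷_) e

toDyck-onto : ∀ p → T (dyckFromᵇ 0 p) → longAscents p ≤ 1 → Σ (List Bool) λ w → Canonical w × toDyck w ≡ p
toDyck-onto []          _  _  = [] , canonical-[] , refl
toDyck-onto (U ∷ D ∷ r) dk la =
  let (w , c , e) = toDyck-onto r dk la in true ∷ w , canonical-true c , cong (λ x → U ∷ D ∷ x) e
toDyck-onto (U ∷ U ∷ r) dk (s≤s la) with ups-D-split r 1 dk
... | j , r′ , refl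
  with shortAscentPath-onto r′ (suc j) (trans (sym (skipU-ups j r′)) (n≤0⇒n≡0 la))
         (subst T (trans (dyckFromᵇ-ups 2 j (D ∷ r′)) (cong (λ x → dyckFromᵇ x (D ∷ r′)) (+-comm j 2))) dk)
... | v , t≡1+j , refl =
  false ∷ v , canonical-false (subst (1 ≤_) (sym t≡1+j) (s≤s z≤n)) ,
  cong (λ t → U ∷ ups t (D ∷ shortAscentPath v)) t≡1+j

fromShortAscentPath : List Step → List Bool
fromShortAscentPath (D ∷ r)     = true ∷ fromShortAscentPath r
fromShortAscentPath (U ∷ D ∷ r) = false ∷ fromShortAscentPath r
fromShortAscentPath _           = []

afterFirstD : List Step → List Step
afterFirstD []      = []
afterFirstD (U ∷ r) = afterFirstD r
afterFirstD (D ∷ r) = r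

fromDyck : List Step → List Bool
fromDyck (U ∷ D ∷ r) = true ∷ fromDyck r
fromDyck (U ∷ U ∷ r) = false ∷ fromShortAscentPath (afterFirstD r)
fromDyck _           = []

fromShortAscentPath-shortAscentPath : ∀ v → fromShortAscentPath (shortAscentPath v) ≡ v
fromShortAscentPath-shortAscentPath []          = refl
fromShortAscentPath-shortAscentPath (true ∷ v)  = cong (true ∷_) (fromShortAscentPath-shortAscentPath v)
fromShortAscentPath-shortAscentPath (false ∷ v) = cong (false ∷_) (fromShortAscentPath-shortAscentPath v)

afterFirstD-ups : ∀ j r → afterFirstD (ups j (D ∷ r)) ≡ r
afterFirstD-ups zero    r = refl
afterFirstD-ups (suc j) r = afterFirstD-ups j r

fromDyck-toDyck : ∀ {w} → Canonical w → fromDyck (toDyck w) ≡ w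
fromDyck-toDyck canonical-[]                          = refl
fromDyck-toDyck (canonical-true c)                    = cong (true ∷_) (fromDyck-toDyck c)
fromDyck-toDyck (canonical-false {v} 1≤t) with countTrue v
... | suc t = cong (false ∷_) (trans (cong fromShortAscentPath (afterFirstD-ups t (shortAscentPath v)))
                                      (fromShortAscentPath-shortAscentPath v))

toDyck-injective : ∀ {w w′} → Canonical w → Canonical w′ → toDyck w ≡ toDyck w′ → w ≡ w′
toDyck-injective c c′ e = trans (sym (fromDyck-toDyck c)) (trans (cong fromDyck e) (fromDyck-toDyck c′))

Words↔GDyck : ∀ n m → Words n m ↔ GDyck n m
Words↔GDyck n m =
  ↔-image (λ p → isGrassmannianDyckᵇ n p ∧ (highPeaks p ≤ᵇ m)) toDyck IsWord-irrelevant
          sound (λ (c , _) (c′ , _) → toDyck-injective c c′) onto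
  where
  sound : ∀ {w} → IsWord n m w → T (isGrassmannianDyckᵇ n (toDyck w) ∧ (highPeaks (toDyck w) ≤ᵇ m))
  sound {w} (_ , refl , cf≤m) =
    T-∧⁺ (T-∧⁺ (T-∧⁺ (≡⇒≡ᵇ _ _ (length-toDyck w)) (toDyck-dyck w))
               (≤⇒≤ᵇ (longAscents-toDyck w)))
         (≤⇒≤ᵇ (subst (_≤ m) (sym (highPeaks-toDyck w)) cf≤m))

  onto : ∀ p → T (isGrassmannianDyckᵇ n p ∧ (highPeaks p ≤ᵇ m)) →
         Σ (List Bool) λ w → IsWord n m w × toDyck w ≡ p
  onto p t with T-∧⁻ {isGrassmannianDyckᵇ n p} t
  ... | gd , hp≤m with T-∧⁻ {isDyckᵇ n p} gd
  ... | dyck , la≤1 with T-∧⁻ {length p ≡ᵇ n + n} dyck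
  ... | |p|≡2n , dk with toDyck-onto p dk (≤ᵇ⇒≤ _ _ la≤1)
  ... | w , c , refl =
    w , (c , m+m≡n+n⇒m≡n (trans (sym (length-toDyck w)) (≡ᵇ⇒≡ _ _ |p|≡2n)) ,
         subst (_≤ m) (highPeaks-toDyck w) (≤ᵇ⇒≤ _ _ hp≤m)) , refl

data Increasing : ℕ → List ℕ → Set where
  []  : ∀ {lo} → Increasing lo []
  _∷_ : ∀ {lo x xs} → lo ≤ x → Increasing (suc x) xs → Increasing lo (x ∷ xs)

Increasing-weaken : ∀ {lo lo′ xs} → lo′ ≤ lo → Increasing lo xs → Increasing lo′ xs
Increasing-weaken _     []           = []
Increasing-weaken lo′≤lo (lo≤x ∷ xs) = ≤-trans lo′≤lo lo≤x ∷ xs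

Increasing-lift : ∀ {lo lo′ xs} → Increasing lo xs → All (lo′ ≤_) xs → Increasing lo′ xs
Increasing-lift []         []          = []
Increasing-lift (_ ∷ inc) (lo′≤x ∷ _) = lo′≤x ∷ inc

Increasing⇒All : ∀ {lo xs} → Increasing lo xs → All (lo ≤_) xs
Increasing⇒All []            = []
Increasing⇒All (lo≤x ∷ inc) = lo≤x ∷ All.map (λ x<y → ≤-trans lo≤x (<⇒≤ x<y)) (Increasing⇒All inc)

Increasing-∌ : ∀ {s xs} → Increasing (suc s) xs → s ∉ xs
Increasing-∌ inc s∈ = <-irrefl refl (All.lookup (Increasing⇒All inc) s∈)

Increasing-resp-⊆ : ∀ {lo xs ys} → ys ⊆ xs → Increasing lo xs → Increasing lo ys
Increasing-resp-⊆ []         []             = []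
Increasing-resp-⊆ (x ∷ʳ ys⊆) (lo≤x ∷ inc)   =
  Increasing-resp-⊆ ys⊆ (Increasing-weaken (m≤n⇒m≤1+n lo≤x) inc)
Increasing-resp-⊆ (refl ∷ ys⊆) (lo≤x ∷ inc) = lo≤x ∷ Increasing-resp-⊆ ys⊆ inc

Increasing⇒Unique : ∀ {lo xs} → Increasing lo xs → Unique xs
Increasing⇒Unique []        = []
Increasing⇒Unique (_ ∷ inc) = All.map <⇒≢ (Increasing⇒All inc) ∷ Increasing⇒Unique inc

Increasing⇒descents≡0 : ∀ {lo xs} → Increasing lo xs → descents xs ≡ 0
Increasing⇒descents≡0 []                     = refl
Increasing⇒descents≡0 (_ ∷ [])               = refl
Increasing⇒descents≡0 (_ ∷ inc@(x<y ∷ _)) with Increasing⇒descents≡0 inc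
... | ih rewrite <ᵇ-false (<⇒≤ x<y) = ih

descents-++ : ∀ {lo lo′ A B} → Increasing lo A → Increasing lo′ B → descents (A ++ B) ≤ 1
descents-++ []                    incB = ≤-trans (≤-reflexive (Increasing⇒descents≡0 incB)) z≤n
descents-++ {A = a ∷ []} {[]}    _ _   = z≤n
descents-++ {A = a ∷ []} {b ∷ B} _ incB rewrite Increasing⇒descents≡0 incB | +-identityʳ (if b <ᵇ a then 1 else 0)
  with b <ᵇ a
... | true  = ≤-refl
... | false = z≤n
descents-++ (_ ∷ inc@(x<y ∷ _)) incB with descents-++ inc incB
... | ih rewrite <ᵇ-false (<⇒≤ x<y) = ih

descents≡0⇒Increasing : ∀ {xs} → Unique xs → descents xs ≡ 0 → Increasing 0 xs
descents≡0⇒Increasing {[]}         _                 _ = []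
descents≡0⇒Increasing {x ∷ []}     _                 _ = z≤n ∷ []
descents≡0⇒Increasing {x ∷ y ∷ xs} ((x≢y ∷ _) ∷ u) d with y <ᵇ x | <ᵇ-reflects-< y x
... | false | ofⁿ y≮x with descents≡0⇒Increasing u d
...   | _ ∷ inc = z≤n ∷ ≤∧≢⇒< (≮⇒≥ y≮x) x≢y ∷ inc

range : ℕ → ℕ → List ℕ
range s zero    = []
range s (suc n) = s ∷ range (suc s) n

length-range : ∀ s n → length (range s n) ≡ n
length-range s zero    = refl
length-range s (suc n) = cong suc (length-range (suc s) n)

range-increasing : ∀ s n → Increasing s (range s n)
range-increasing s zero    = []
range-increasing s (suc n) = ≤-refl ∷ range-increasing (suc s) n

range-< : ∀ s n → All (_< s + n) (range s n)
range-< s zero    = []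
range-< s (suc n) =
  subst (s <_) (sym (+-suc s n)) (s≤s (m≤m+n s n)) ∷
  All.map (λ {x} x< → subst (x <_) (sym (+-suc s n)) x<) (range-< (suc s) n)

pigeonhole : ∀ {s xs} → Increasing s xs → All (_< s + length xs) xs → xs ≡ range s (length xs)
pigeonhole []                 []              = refl
pigeonhole {s} {x ∷ []} (s≤x ∷ []) (x<s+1 ∷ []) =
  cong (_∷ []) (≤-antisym (≤-pred (subst (x <_) (+-comm s 1) x<s+1)) s≤x)
pigeonhole {s} {x ∷ _} (s≤x ∷ inc@(x<y ∷ _)) (_ ∷ ys<) with pigeonhole (Increasing-weaken (s≤s s≤x) inc)
                                                       (All.map (λ {y} → subst (y <_) (+-suc s _)) ys<)
... | ys≡range = cong₂ _∷_ (≤-antisym (≤-pred (subst (x <_) (∷-injectiveˡ ys≡range) x<y)) s≤x) ys≡range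

firstBlock : ℕ → List Bool → List ℕ
firstBlock s []          = []
firstBlock s (true ∷ w)  = s ∷ firstBlock (suc s) w
firstBlock s (false ∷ w) = firstBlock (suc s) w

secondBlock : ℕ → List Bool → List ℕ
secondBlock s []          = []
secondBlock s (true ∷ w)  = secondBlock (suc s) w
secondBlock s (false ∷ w) = s ∷ secondBlock (suc s) w

-- Letter i of w says whether the value s + i comes before the descent.
toPerm : ℕ → List Bool → List ℕ
toPerm s w = firstBlock s w ++ secondBlock s w

firstBlock-⊆ : ∀ s w → firstBlock s w ⊆ range s (length w)
firstBlock-⊆ s []          = []
firstBlock-⊆ s (true ∷ w)  = refl ∷ firstBlock-⊆ (suc s) w
firstBlock-⊆ s (false ∷ w) = s ∷ʳ firstBlock-⊆ (suc s) w

secondBlock-⊆ : ∀ s w → secondBlock s w ⊆ range s (length w)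
secondBlock-⊆ s []          = []
secondBlock-⊆ s (true ∷ w)  = s ∷ʳ secondBlock-⊆ (suc s) w
secondBlock-⊆ s (false ∷ w) = refl ∷ secondBlock-⊆ (suc s) w

firstBlock-increasing : ∀ s w → Increasing s (firstBlock s w)
firstBlock-increasing s w = Increasing-resp-⊆ (firstBlock-⊆ s w) (range-increasing s (length w))

secondBlock-increasing : ∀ s w → Increasing s (secondBlock s w)
secondBlock-increasing s w = Increasing-resp-⊆ (secondBlock-⊆ s w) (range-increasing s (length w))

length-firstBlock : ∀ s w → length (firstBlock s w) ≡ countTrue w
length-firstBlock s []          = refl
length-firstBlock s (true ∷ w)  = cong suc (length-firstBlock (suc s) w)
length-firstBlock s (false ∷ w) = length-firstBlock (suc s) w

toPerm-↭-range : ∀ s w → toPerm s w ↭ range s (length w)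
toPerm-↭-range s []          = ↭-refl
toPerm-↭-range s (true ∷ w)  = prep s (toPerm-↭-range (suc s) w)
toPerm-↭-range s (false ∷ w) =
  ↭-trans (shift s (firstBlock (suc s) w) (secondBlock (suc s) w)) (prep s (toPerm-↭-range (suc s) w))

length-toPerm : ∀ s w → length (toPerm s w) ≡ length w
length-toPerm s w = trans (↭-length (toPerm-↭-range s w)) (length-range s (length w))

toPerm-unique : ∀ s w → Unique (toPerm s w)
toPerm-unique s w =
  Unique-resp-↭ (↭⇒↭ₛ (↭-sym (toPerm-↭-range s w))) (Increasing⇒Unique (range-increasing s (length w)))

toPerm-bounded : ∀ s w → All (λ x → s ≤ x × x < s + length w) (toPerm s w)
toPerm-bounded s w = All-resp-↭ (↭-sym (toPerm-↭-range s w))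
  (All.zip (Increasing⇒All (range-increasing s (length w)) , range-< s (length w)))

HeadBelow : List ℕ → List ℕ → Set
HeadBelow A []      = ⊤
HeadBelow A (b ∷ _) = Any (b <_) A

HeadBelow-∷⁺ : ∀ {a A} B → HeadBelow A B → HeadBelow (a ∷ A) B
HeadBelow-∷⁺ []      _ = _
HeadBelow-∷⁺ (_ ∷ _) h = there h

HeadBelow-∷⁻ : ∀ {a A} B → All (a <_) B → HeadBelow (a ∷ A) B → HeadBelow A B
HeadBelow-∷⁻ []      _           _         = _
HeadBelow-∷⁻ (_ ∷ _) (a<b ∷ _) (here b<a) = contradiction a<b (<⇒≯ b<a)
HeadBelow-∷⁻ (_ ∷ _) _          (there h)  = h

splitAtDescent : ∀ π → Unique π → descents π ≤ 1 →
  Σ (List ℕ) λ A → Σ (List ℕ) λ B → π ≡ A ++ B × Increasing 0 A × Increasing 0 B × HeadBelow A B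
splitAtDescent []      _ _ = [] , [] , refl , [] , [] , _
splitAtDescent (x ∷ []) _ _ = x ∷ [] , [] , refl , z≤n ∷ [] , [] , _
splitAtDescent (x ∷ y ∷ r) ((x≢y ∷ _) ∷ u) d with y <ᵇ x | <ᵇ-reflects-< y x
... | true  | ofʸ y<x = x ∷ [] , y ∷ r , refl , z≤n ∷ [] ,
                         descents≡0⇒Increasing u (n≤0⇒n≡0 (≤-pred d)) , here y<x
... | false | ofⁿ y≮x with splitAtDescent (y ∷ r) u d
...   | []          , B , refl , _ , _ , ()
...   | .y ∷ A , B , refl , _ ∷ incA , incB , h =
  x ∷ y ∷ A , B , refl , z≤n ∷ ≤∧≢⇒< (≮⇒≥ y≮x) x≢y ∷ incA , incB , HeadBelow-∷⁺ B h

merge : List ℕ → List ℕ → List (ℕ × Bool)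
merge []      []      = []
merge (a ∷ A) []      = (a , true) ∷ merge A []
merge []      (b ∷ B) = (b , false) ∷ merge [] B
merge (a ∷ A) (b ∷ B) = if a <ᵇ b then (a , true) ∷ merge A (b ∷ B) else (b , false) ∷ merge (a ∷ A) B

merge-↭ : ∀ A B → map proj₁ (merge A B) ↭ A ++ B
merge-↭ []      []      = ↭-refl
merge-↭ (a ∷ A) []      = prep a (merge-↭ A [])
merge-↭ []      (b ∷ B) = prep b (merge-↭ [] B)
merge-↭ (a ∷ A) (b ∷ B) with merge-↭ A (b ∷ B) | merge-↭ (a ∷ A) B | a <ᵇ b
... | ih₁ | _   | true  = prep a ih₁
... | _   | ih₂ | false = ↭-trans (prep b ih₂) (↭-sym (shift b (a ∷ A) B))

merge-increasing : ∀ {lo} A B → Increasing lo A → Increasing lo B → Disjoint A B →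
                   Increasing lo (map proj₁ (merge A B))
merge-increasing []      []      []             []             _ = []
merge-increasing (a ∷ A) []      (lo≤a ∷ incA) []             _ = lo≤a ∷ merge-increasing A [] incA [] (λ ())
merge-increasing []      (b ∷ B) []             (lo≤b ∷ incB) _ = lo≤b ∷ merge-increasing [] B [] incB (λ ())
merge-increasing (a ∷ A) (b ∷ B) (lo≤a ∷ incA) (lo≤b ∷ incB) disj
  with merge-increasing A (b ∷ B) incA | merge-increasing {suc b} (a ∷ A) B | a <ᵇ b | <ᵇ-reflects-< a b
... | ih₁ | _   | true  | ofʸ a<b =
  lo≤a ∷ ih₁ (a<b ∷ incB) (λ (x∈A , x∈bB) → disj (there x∈A , x∈bB))
... | _   | ih₂ | false | ofⁿ a≮b =
  lo≤b ∷ ih₂ (b<a ∷ incA) incB (λ (x∈aA , x∈B) → disj (x∈aA , there x∈B))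
  where
  b<a : b < a
  b<a = ≤∧≢⇒< (≮⇒≥ a≮b) (λ b≡a → disj (here refl , here (sym b≡a)))

merge-blocks : ∀ s k A B → map proj₁ (merge A B) ≡ range s k →
               firstBlock s (map proj₂ (merge A B)) ≡ A × secondBlock s (map proj₂ (merge A B)) ≡ B
merge-blocks s k [] [] _ = refl , refl
merge-blocks s (suc k) (a ∷ A) [] e with ∷-injective e
... | refl , e′ = let (f , g) = merge-blocks (suc s) k A [] e′ in cong (a ∷_) f , g
merge-blocks s (suc k) [] (b ∷ B) e with ∷-injective e
... | refl , e′ = let (f , g) = merge-blocks (suc s) k [] B e′ in f , cong (b ∷_) g
merge-blocks s zero (a ∷ A) (b ∷ B) e with a <ᵇ b
merge-blocks s zero (a ∷ A) (b ∷ B) () | true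
merge-blocks s zero (a ∷ A) (b ∷ B) () | false
merge-blocks s (suc k) (a ∷ A) (b ∷ B) e with a <ᵇ b
... | true  with ∷-injective e
...   | refl , e′ = let (f , g) = merge-blocks (suc s) k A (b ∷ B) e′ in cong (a ∷_) f , g
merge-blocks s (suc k) (a ∷ A) (b ∷ B) e | false with ∷-injective e
...   | refl , e′ = let (f , g) = merge-blocks (suc s) k (a ∷ A) B e′ in f , cong (b ∷_) g

headBelow⇒Canonical : ∀ s w → HeadBelow (firstBlock s w) (secondBlock s w) → Canonical w
headBelow⇒Canonical s []          _ = canonical-[]
headBelow⇒Canonical s (true ∷ w)  h =
  canonical-true (headBelow⇒Canonical (suc s) w
    (HeadBelow-∷⁻ (secondBlock (suc s) w) (Increasing⇒All (secondBlock-increasing (suc s) w)) h))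
headBelow⇒Canonical s (false ∷ w) h =
  canonical-false (subst (1 ≤_) (length-firstBlock (suc s) w) (Any⇒1≤length h))

-- Merging A and B, tagging each value with its block, lists the values 1, …, n (by pigeonhole);
-- the tags form the word.
toPerm-onto : ∀ n π → length π ≡ n → All (λ x → 1 ≤ x × x ≤ n) π → Unique π → descents π ≤ 1 →
              Σ (List Bool) λ w → (Canonical w × length w ≡ n) × toPerm 1 w ≡ π
toPerm-onto n π |π|≡n bounds u d with splitAtDescent π u d
... | A , B , refl , incA , incB , h = w , (canonical , |w|≡n) , cong₂ _++_ (proj₁ blocks) (proj₂ blocks)
  where
  w : List Bool
  w = map proj₂ (merge A B)

  values : List ℕ
  values = map proj₁ (merge A B)

  |values|≡n : length values ≡ n
  |values|≡n = trans (↭-length (merge-↭ A B)) |π|≡n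

  |w|≡n : length w ≡ n
  |w|≡n = trans (length-map proj₂ (merge A B)) (trans (sym (length-map proj₁ (merge A B))) |values|≡n)

  values-bounds : All (λ x → 1 ≤ x × x ≤ n) values
  values-bounds = All-resp-↭ (↭-sym (merge-↭ A B)) bounds

  values≡range : values ≡ range 1 (length values)
  values≡range = pigeonhole
    (Increasing-lift (merge-increasing A B incA incB (Unique-++⇒Disjoint A u)) (All.map proj₁ values-bounds))
    (All.map (λ (_ , x≤n) → s≤s (subst (_ ≤_) (sym |values|≡n) x≤n)) values-bounds)

  blocks : firstBlock 1 w ≡ A × secondBlock 1 w ≡ B
  blocks = merge-blocks 1 (length values) A B values≡range

  canonical : Canonical w
  canonical = headBelow⇒Canonical 1 w (subst₂ HeadBelow (sym (proj₁ blocks)) (sym (proj₂ blocks)) h)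

++-∷-cancel : ∀ {x} xs xs′ {ys ys′ : List ℕ} → x ∉ xs → x ∉ xs′ →
              xs ++ x ∷ ys ≡ xs′ ++ x ∷ ys′ → xs ≡ xs′ × ys ≡ ys′
++-∷-cancel []       []        _     _      e = refl , ∷-injectiveʳ e
++-∷-cancel []       (x′ ∷ xs′) _     x∉x′∷ e = contradiction (here (∷-injectiveˡ e)) x∉x′∷
++-∷-cancel (x′ ∷ xs) []        x∉x′∷ _     e = contradiction (here (sym (∷-injectiveˡ e))) x∉x′∷
++-∷-cancel (a ∷ xs) (a′ ∷ xs′) x∉a∷ x∉a′∷ e with ∷-injective e
... | refl , e′ =
  let (xs≡ , ys≡) = ++-∷-cancel xs xs′ (x∉a∷ ∘ there) (x∉a′∷ ∘ there) e′ in cong (a ∷_) xs≡ , ys≡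

blocks-injective : ∀ s w w′ → firstBlock s w ≡ firstBlock s w′ → secondBlock s w ≡ secondBlock s w′ →
                   w ≡ w′
blocks-injective s []          []           _  _  = refl
blocks-injective s (true ∷ w)  (true ∷ w′)  e₁ e₂ =
  cong (true ∷_) (blocks-injective (suc s) w w′ (∷-injectiveʳ e₁) e₂)
blocks-injective s (false ∷ w) (false ∷ w′) e₁ e₂ =
  cong (false ∷_) (blocks-injective (suc s) w w′ e₁ (∷-injectiveʳ e₂))
blocks-injective s (true ∷ w)  (false ∷ w′) e₁ _  =
  ⊥-elim (Increasing-∌ (firstBlock-increasing (suc s) w′) (subst (s ∈_) e₁ (here refl)))
blocks-injective s (false ∷ w) (true ∷ w′)  e₁ _  =
  ⊥-elim (Increasing-∌ (firstBlock-increasing (suc s) w) (subst (s ∈_) (sym e₁) (here refl)))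
blocks-injective s []          (true ∷ w′)  () _
blocks-injective s []          (false ∷ w′) _  ()
blocks-injective s (true ∷ w)  []           () _
blocks-injective s (false ∷ w) []           _  ()

∷≢above++ : ∀ {s ys zs} xs → Increasing (suc s) xs → 1 ≤ length xs → s ∷ ys ≢ xs ++ zs
∷≢above++ (x ∷ _) (s<x ∷ _) _ e = <-irrefl (∷-injectiveˡ e) s<x

-- toPerm s w starts with s iff w starts with true; otherwise s follows the (nonempty) first block,
-- and cancelling it recovers both blocks.
toPerm-injective : ∀ s {w w′} → Canonical w → Canonical w′ → toPerm s w ≡ toPerm s w′ → w ≡ w′
toPerm-injective s canonical-[]        canonical-[]        _ = refl
toPerm-injective s canonical-[] (canonical-false {v} _) e =
  ⊥-elim (0≢1+n (trans (cong length e) (length-toPerm s (false ∷ v))))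
toPerm-injective s (canonical-false {v} _) canonical-[] e =
  ⊥-elim (0≢1+n (trans (cong length (sym e)) (length-toPerm s (false ∷ v))))
toPerm-injective s (canonical-true c)  (canonical-true c′) e =
  cong (true ∷_) (toPerm-injective (suc s) c c′ (∷-injectiveʳ e))
toPerm-injective s (canonical-false {v} _) (canonical-false {v′} _) e =
  let (firstBlock≡ , secondBlock≡) = ++-∷-cancel (firstBlock (suc s) v) (firstBlock (suc s) v′)
                                       (Increasing-∌ (firstBlock-increasing (suc s) v))
                                       (Increasing-∌ (firstBlock-increasing (suc s) v′)) e
  in cong (false ∷_) (blocks-injective (suc s) v v′ firstBlock≡ secondBlock≡)
toPerm-injective s (canonical-true _) (canonical-false {v} 1≤t) e =
  ⊥-elim (∷≢above++ (firstBlock (suc s) v) (firstBlock-increasing (suc s) v)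
                      (subst (1 ≤_) (sym (length-firstBlock (suc s) v)) 1≤t) e)
toPerm-injective s (canonical-false {v} 1≤t) (canonical-true _) e =
  ⊥-elim (∷≢above++ (firstBlock (suc s) v) (firstBlock-increasing (suc s) v)
                      (subst (1 ≤_) (sym (length-firstBlock (suc s) v)) 1≤t) (sym e))

elemᵇ⇒∈ : ∀ x xs → T (elemᵇ x xs) → x ∈ xs
elemᵇ⇒∈ x (y ∷ ys) t with Equivalence.to (T-∨ {x ≡ᵇ y}) t
... | inj₁ x≡ᵇy = here (≡ᵇ⇒≡ x y x≡ᵇy)
... | inj₂ x∈ys = there (elemᵇ⇒∈ x ys x∈ys)

∈⇒elemᵇ : ∀ {x xs} → x ∈ xs → T (elemᵇ x xs)
∈⇒elemᵇ {x} (here refl) = Equivalence.from T-∨ (inj₁ (≡⇒≡ᵇ x x refl))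
∈⇒elemᵇ {x} {y ∷ _} (there x∈) = Equivalence.from (T-∨ {x ≡ᵇ y}) (inj₂ (∈⇒elemᵇ x∈))

distinctᵇ⇒Unique : ∀ xs → T (distinctᵇ xs) → Unique xs
distinctᵇ⇒Unique []       _ = []
distinctᵇ⇒Unique (x ∷ xs) t =
  let (x∉ , d) = T-∧⁻ {not (elemᵇ x xs)} t
  in All.¬Any⇒All¬ xs (T-not⁻ x∉ ∘ ∈⇒elemᵇ) ∷ distinctᵇ⇒Unique xs d

Unique⇒distinctᵇ : ∀ {xs} → Unique xs → T (distinctᵇ xs)
Unique⇒distinctᵇ []                  = _
Unique⇒distinctᵇ {x ∷ xs} (x∉ ∷ u) =
  T-∧⁺ (T-not⁺ (All.All¬⇒¬Any x∉ ∘ elemᵇ⇒∈ x xs)) (Unique⇒distinctᵇ u)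

isPermᵇ⇒ : ∀ n π → T (isPermᵇ n π) → length π ≡ n × All (λ x → 1 ≤ x × x ≤ n) π × Unique π
isPermᵇ⇒ n π t =
  let (|π|≡ᵇn , bounded-distinct) = T-∧⁻ {length π ≡ᵇ n} t
      (bounded , distinct) = T-∧⁻ {all (λ x → (1 ≤ᵇ x) ∧ (x ≤ᵇ n)) π} bounded-distinct
  in ≡ᵇ⇒≡ _ _ |π|≡ᵇn , All.map inBounds (All.all⁺ _ π bounded) , distinctᵇ⇒Unique π distinct
  where
  inBounds : ∀ {x} → T ((1 ≤ᵇ x) ∧ (x ≤ᵇ n)) → 1 ≤ x × x ≤ n
  inBounds {x} t = let (1≤ᵇx , x≤ᵇn) = T-∧⁻ {1 ≤ᵇ x} t in ≤ᵇ⇒≤ 1 x 1≤ᵇx , ≤ᵇ⇒≤ x n x≤ᵇn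

⇒isPermᵇ : ∀ n π → length π ≡ n → All (λ x → 1 ≤ x × x ≤ n) π → Unique π → T (isPermᵇ n π)
⇒isPermᵇ n π |π|≡n bounded distinct =
  T-∧⁺ (≡⇒≡ᵇ _ _ |π|≡n)
       (T-∧⁺ (All.all⁻ _ (All.map (λ (1≤x , x≤n) → T-∧⁺ (≤⇒≤ᵇ 1≤x) (≤⇒≤ᵇ x≤n)) bounded))
             (Unique⇒distinctᵇ distinct))

∈-subseqs⇒⊆ : ∀ m xs {τ} → τ ∈ subseqs m xs → τ ⊆ xs × length τ ≡ m
∈-subseqs⇒⊆ zero    xs       (here refl) = minimum xs , refl
∈-subseqs⇒⊆ (suc m) (x ∷ xs) τ∈ with ∈-++⁻ (map (x ∷_) (subseqs m xs)) τ∈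
... | inj₁ τ∈map with ∈-map⁻ (x ∷_) τ∈map
...   | τ′ , τ′∈ , refl =
  let (τ′⊆ , |τ′|≡m) = ∈-subseqs⇒⊆ m xs τ′∈ in refl ∷ τ′⊆ , cong suc |τ′|≡m
∈-subseqs⇒⊆ (suc m) (x ∷ xs) τ∈ | inj₂ τ∈rest =
  let (τ⊆ , |τ|≡) = ∈-subseqs⇒⊆ (suc m) xs τ∈rest in x ∷ʳ τ⊆ , |τ|≡

⊆⇒∈-subseqs : ∀ {τ xs} → τ ⊆ xs → τ ∈ subseqs (length τ) xs
⊆⇒∈-subseqs {[]}         _            = here refl
⊆⇒∈-subseqs {_ ∷ _} (x ∷ʳ τ⊆)        = ∈-++⁺ʳ (map (x ∷_) _) (⊆⇒∈-subseqs τ⊆)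
⊆⇒∈-subseqs {x ∷ _} (refl ∷ τ⊆)      = ∈-++⁺ˡ (∈-map⁺ (x ∷_) (⊆⇒∈-subseqs τ⊆))

containsᵇ⇒ : ∀ σ π → T (containsᵇ σ π) →
             Σ (List ℕ) λ τ → τ ⊆ π × length τ ≡ length σ × T (orderIsoᵇ τ σ)
containsᵇ⇒ σ π t =
  let (τ , τ∈ , iso) = find (Any.any⁻ (λ τ → orderIsoᵇ τ σ) (subseqs (length σ) π) t)
      (τ⊆ , |τ|≡) = ∈-subseqs⇒⊆ (length σ) π τ∈
  in τ , τ⊆ , |τ|≡ , iso

⇒containsᵇ : ∀ {σ π τ} → τ ⊆ π → length τ ≡ length σ → T (orderIsoᵇ τ σ) → T (containsᵇ σ π)
⇒containsᵇ {σ} {π} {τ} τ⊆ |τ|≡ iso =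
  Any.any⁺ (λ τ → orderIsoᵇ τ σ) (lose (subst (λ m → τ ∈ subseqs m π) |τ|≡ (⊆⇒∈-subseqs τ⊆)) iso)

SameComparisons : List ℕ → List ℕ → Set
SameComparisons τ σ = ∀ {i j} → i < length σ → j < length σ →
                      (lookupᵇ τ i <ᵇ lookupᵇ τ j) ≡ (lookupᵇ σ i <ᵇ lookupᵇ σ j)

orderIsoᵇ⇒ : ∀ τ σ → T (orderIsoᵇ τ σ) → length τ ≡ length σ × SameComparisons τ σ
orderIsoᵇ⇒ τ σ t =
  let (|τ|≡ᵇ , comparisons) = T-∧⁻ {length τ ≡ᵇ length σ} t
  in ≡ᵇ⇒≡ _ _ |τ|≡ᵇ ,
     λ i< j< → agree _ _ (All.applyUpTo⁻ id _ (All.all⁺ _ _ (All.applyUpTo⁻ id _ (All.all⁺ _ _ comparisons) i<)) j<)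
  where
  agree : ∀ a b → T ((a ∧ b) ∨ (not a ∧ not b)) → a ≡ b
  agree true  true  _ = refl
  agree false false _ = refl

⇒orderIsoᵇ : ∀ τ σ → length τ ≡ length σ → SameComparisons τ σ → T (orderIsoᵇ τ σ)
⇒orderIsoᵇ τ σ |τ|≡ comparisons =
  T-∧⁺ (≡⇒≡ᵇ _ _ |τ|≡)
       (All.all⁻ _ (All.applyUpTo⁺₁ id _ λ i< →
          All.all⁻ _ (All.applyUpTo⁺₁ id _ λ j< → agree _ _ (comparisons i< j<))))
  where
  agree : ∀ a b → a ≡ b → T ((a ∧ b) ∨ (not a ∧ not b))
  agree true  _ refl = _
  agree false _ refl = _

All-lookupᵇ : ∀ {P : ℕ → Set} {ys} → All P ys → ∀ {i} → i < length ys → P (lookupᵇ ys i)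
All-lookupᵇ (p ∷ _)  {zero}  _         = p
All-lookupᵇ (_ ∷ ps) {suc i} (s≤s i<) = All-lookupᵇ ps i<

lookupᵇ⇒All : ∀ {P : ℕ → Set} ys → (∀ {i} → i < length ys → P (lookupᵇ ys i)) → All P ys
lookupᵇ⇒All []       _ = []
lookupᵇ⇒All (y ∷ ys) p = p (s≤s z≤n) ∷ lookupᵇ⇒All ys (p ∘ s≤s)

Increasing-comparisons : ∀ {lo ys} → Increasing lo ys → ∀ {i j} → i < length ys → j < length ys →
                         (lookupᵇ ys i <ᵇ lookupᵇ ys j) ≡ (i <ᵇ j)
Increasing-comparisons {ys = y ∷ _} _ {zero} {zero} _ _ = <ᵇ-false (≤-refl {y})
Increasing-comparisons (_ ∷ inc) {zero}  {suc j} _ (s≤s j<) = <ᵇ-true (All-lookupᵇ (Increasing⇒All inc) j<)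
Increasing-comparisons (_ ∷ inc) {suc i} {zero}  (s≤s i<) _ =
  <ᵇ-false (<⇒≤ (All-lookupᵇ (Increasing⇒All inc) i<))
Increasing-comparisons (_ ∷ inc) {suc i} {suc j} (s≤s i<) (s≤s j<) = Increasing-comparisons inc i< j<

data PatternShaped : List ℕ → Set where
  shaped : ∀ {lo x ys} → Increasing lo ys → All (_< x) ys → PatternShaped (x ∷ ys)

patternOrderᵇ : ℕ → ℕ → Bool
patternOrderᵇ zero    _       = false
patternOrderᵇ (suc i) zero    = true
patternOrderᵇ (suc i) (suc j) = i <ᵇ j

shaped-comparisons : ∀ {τ} → PatternShaped τ → ∀ {i j} → i < length τ → j < length τ →
                     (lookupᵇ τ i <ᵇ lookupᵇ τ j) ≡ patternOrderᵇ i j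
shaped-comparisons {x ∷ _} _ {zero} {zero} _ _ = <ᵇ-false (≤-refl {x})
shaped-comparisons (shaped _ below) {zero}  {suc j} _ (s≤s j<) = <ᵇ-false (<⇒≤ (All-lookupᵇ below j<))
shaped-comparisons (shaped _ below) {suc i} {zero}  (s≤s i<) _ = <ᵇ-true (All-lookupᵇ below i<)
shaped-comparisons (shaped inc _)   {suc i} {suc j} (s≤s i<) (s≤s j<) = Increasing-comparisons inc i< j<

shaped⇒orderIsoᵇ : ∀ {τ σ} → PatternShaped τ → PatternShaped σ → length τ ≡ length σ →
                   T (orderIsoᵇ τ σ)
shaped⇒orderIsoᵇ {τ} {σ} τ-shaped σ-shaped |τ|≡ = ⇒orderIsoᵇ τ σ |τ|≡ λ i< j< →
  trans (shaped-comparisons τ-shaped (subst (_ <_) (sym |τ|≡) i<) (subst (_ <_) (sym |τ|≡) j<))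
        (sym (shaped-comparisons σ-shaped i< j<))

orderIsoᵇ-shaped⇒below : ∀ {x ys σ} → PatternShaped σ → T (orderIsoᵇ (x ∷ ys) σ) → All (_< x) ys
orderIsoᵇ-shaped⇒below {x} {ys} {σ} σ-shaped iso = lookupᵇ⇒All ys below
  where
  |τ|≡|σ| = proj₁ (orderIsoᵇ⇒ (x ∷ ys) σ iso)

  bound : ∀ {m} → m < suc (length ys) → m < length σ
  bound {m} = subst (m <_) |τ|≡|σ|

  below : ∀ {i} → i < length ys → lookupᵇ ys i < x
  below {i} i< = <ᵇ⇒< _ _ (Equivalence.from T-≡ (begin
    lookupᵇ ys i <ᵇ x                 ≡⟨ proj₂ (orderIsoᵇ⇒ (x ∷ ys) σ iso) (bound (s≤s i<)) (bound z<s) ⟩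
    lookupᵇ σ (suc i) <ᵇ lookupᵇ σ 0  ≡⟨ shaped-comparisons σ-shaped (bound (s≤s i<)) (bound z<s) ⟩
    true                              ∎))
    where open ≡-Reasoning

map-suc-applyUpTo : ∀ f s k → (∀ i → f i ≡ s + i) → map suc (applyUpTo f k) ≡ range (suc s) k
map-suc-applyUpTo f s zero    _  = refl
map-suc-applyUpTo f s (suc k) f≗ =
  cong₂ _∷_ (cong suc (trans (f≗ 0) (+-identityʳ s)))
            (map-suc-applyUpTo (f ∘ suc) (suc s) k (λ i → trans (f≗ (suc i)) (+-suc s i)))

pat≡ : ∀ k → pat (suc k) ≡ suc k ∷ range 1 k
pat≡ k = cong (suc k ∷_) (map-suc-applyUpTo id 0 k (λ _ → refl))

pat-shaped : ∀ k → PatternShaped (pat (suc k))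
pat-shaped k = subst PatternShaped (sym (pat≡ k)) (shaped (range-increasing 1 k) (range-< 1 k))

length-pat : ∀ k → length (pat (suc k)) ≡ suc k
length-pat k = trans (cong length (pat≡ k)) (cong suc (length-range 1 k))

below : ℕ → List ℕ → List ℕ
below x = filter (_<? x)

below-secondBlock-≤ : ∀ s w {x} → x ∈ firstBlock s w → length (below x (secondBlock s w)) ≤ coveredFalses w
below-secondBlock-≤ s (true ∷ w) (here refl) = subst (λ ys → length ys ≤ coveredFalses w)
  (sym (filter-none (_<? s) (All.map <⇒≯ (Increasing⇒All (secondBlock-increasing (suc s) w))))) z≤n
below-secondBlock-≤ s (true ∷ w)  (there x∈) = below-secondBlock-≤ (suc s) w x∈
below-secondBlock-≤ s (false ∷ w) {x} x∈ = begin
  length (below x (s ∷ secondBlock (suc s) w))    ≡⟨ cong length (filter-accept (_<? x) s<x) ⟩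
  suc (length (below x (secondBlock (suc s) w)))  ≤⟨ s≤s (below-secondBlock-≤ (suc s) w x∈) ⟩
  suc (coveredFalses w)                           ≡⟨ coveredFalses-false w 1≤t ⟨
  coveredFalses (false ∷ w)                       ∎
  where
  open ≤-Reasoning

  s<x : s < x
  s<x = All.lookup (Increasing⇒All (firstBlock-increasing (suc s) w)) x∈

  1≤t : 1 ≤ countTrue w
  1≤t = subst (1 ≤_) (length-firstBlock (suc s) w) (Any⇒1≤length x∈)

below-secondBlock-≥ : ∀ s w → 1 ≤ countTrue w →
                      Σ ℕ λ x → x ∈ firstBlock s w × coveredFalses w ≤ length (below x (secondBlock s w))
below-secondBlock-≥ s (true ∷ w) _ with countTrue w in t≡
... | zero  = s , here refl , ≤-trans (≤-reflexive (countTrue≡0⇒coveredFalses≡0 w t≡)) z≤n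
... | suc _ = let (x , x∈ , cf≤) = below-secondBlock-≥ (suc s) w (subst (1 ≤_) (sym t≡) (s≤s z≤n))
              in x , there x∈ , cf≤
below-secondBlock-≥ s (false ∷ w) 1≤t =
  let (x , x∈ , cf≤) = below-secondBlock-≥ (suc s) w 1≤t
      s<x = All.lookup (Increasing⇒All (firstBlock-increasing (suc s) w)) x∈
  in x , x∈ , (begin
    coveredFalses (false ∷ w)                       ≡⟨ coveredFalses-false w 1≤t ⟩
    suc (coveredFalses w)                           ≤⟨ s≤s cf≤ ⟩
    suc (length (below x (secondBlock (suc s) w)))  ≡⟨ cong length (filter-accept (_<? x) s<x) ⟨
    length (below x (s ∷ secondBlock (suc s) w))    ∎)
  where open ≤-Reasoning

⊆-++-dropˡ : ∀ {a ys} A {B} → All (_< a) ys → All (a <_) A → ys ⊆ A ++ B → ys ⊆ B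
⊆-++-dropˡ []      _              _          ys⊆       = ys⊆
⊆-++-dropˡ (_ ∷ A) ys<a           (_ ∷ a<A) (_ ∷ʳ ys⊆) = ⊆-++-dropˡ A ys<a a<A ys⊆
⊆-++-dropˡ (_ ∷ A) (a′<a ∷ _) (a<a′ ∷ _) (refl ∷ _) = contradiction a<a′ (<⇒≯ a′<a)

⊆-++-split : ∀ {lo lo′ x y ys} A {B} → Increasing lo A → Increasing lo′ B → All (_< x) (y ∷ ys) →
             x ∷ y ∷ ys ⊆ A ++ B → x ∈ A × y ∷ ys ⊆ B
⊆-++-split []      _            incB (y<x ∷ _) τ⊆ with Increasing-resp-⊆ τ⊆ incB
... | _ ∷ x<y ∷ _ = contradiction x<y (<⇒≯ y<x)
⊆-++-split (_ ∷ A) (_ ∷ incA) incB below (refl ∷ τ⊆) =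
  here refl , ⊆-++-dropˡ A below (Increasing⇒All incA) τ⊆
⊆-++-split (_ ∷ A) (_ ∷ incA) incB below (_ ∷ʳ τ⊆) =
  let (x∈A , ys⊆B) = ⊆-++-split A incA incB below τ⊆ in there x∈A , ys⊆B

toPerm-contains⇒ : ∀ j s w → T (containsᵇ (pat (suc (suc j))) (toPerm s w)) → suc j ≤ coveredFalses w
toPerm-contains⇒ j s w t with containsᵇ⇒ (pat (suc (suc j))) (toPerm s w) t
... | x ∷ y ∷ ys , τ⊆ , |τ|≡ , iso =
  let y<x = orderIsoᵇ-shaped⇒below (pat-shaped (suc j)) iso
      (x∈ , ys⊆) = ⊆-++-split (firstBlock s w) (firstBlock-increasing s w) (secondBlock-increasing s w) y<x τ⊆
      ys⊆below = subst (_⊆ below x (secondBlock s w)) (filter-all (_<? x) y<x)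
                       (filter⁺ (_<? x) (_<? x) (λ { refl → id }) ys⊆)
  in begin
    suc j                                ≡⟨ suc-injective (trans |τ|≡ (length-pat (suc j))) ⟨
    length (y ∷ ys)                      ≤⟨ length-mono-≤ ys⊆below ⟩
    length (below x (secondBlock s w))   ≤⟨ below-secondBlock-≤ s w x∈ ⟩
    coveredFalses w                      ∎
  where open ≤-Reasoning

toPerm-contains⇐ : ∀ j s w → suc j ≤ coveredFalses w → T (containsᵇ (pat (suc (suc j))) (toPerm s w))
toPerm-contains⇐ j s w 1+j≤cf
  with below-secondBlock-≥ s w (1≤coveredFalses⇒1≤countTrue w (≤-trans (s≤s z≤n) 1+j≤cf))
... | x , x∈ , cf≤ =
  let B    = secondBlock s w
      ys   = take (suc j) (below x B)
      ys⊆  = ⊆-trans (take-⊆ (suc j) (below x B)) (filter-⊆ (_<? x) B)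
      ys<x = All-resp-⊆ (take-⊆ (suc j) (below x B)) (All.all-filter (_<? x) B)
      |τ|≡ = trans (cong suc (trans (length-take (suc j) (below x B)) (m≤n⇒m⊓n≡m (≤-trans 1+j≤cf cf≤))))
                   (sym (length-pat (suc j)))
  in ⇒containsᵇ {pat (suc (suc j))} (++⁺ (from∈ x∈) ys⊆) |τ|≡
       (shaped⇒orderIsoᵇ (shaped (Increasing-resp-⊆ ys⊆ (secondBlock-increasing s w)) ys<x)
                         (pat-shaped (suc j)) |τ|≡)

Words↔𝒢 : ∀ n j → Words n j ↔ 𝒢 n (pat (suc (suc j)))
Words↔𝒢 n j =
  ↔-image (λ π → isPermᵇ n π ∧ isGrassmannianᵇ π ∧ avoidsᵇ σ π) (toPerm 1) IsWord-irrelevant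
          sound (λ (c , _) (c′ , _) → toPerm-injective 1 c c′) onto
  where
  σ : List ℕ
  σ = pat (suc (suc j))

  sound : ∀ {w} → IsWord n j w →
          T (isPermᵇ n (toPerm 1 w) ∧ isGrassmannianᵇ (toPerm 1 w) ∧ avoidsᵇ σ (toPerm 1 w))
  sound {w} (_ , refl , cf≤j) =
    T-∧⁺ (⇒isPermᵇ n (toPerm 1 w) (length-toPerm 1 w)
                   (All.map (λ (1≤x , x<1+n) → 1≤x , ≤-pred x<1+n) (toPerm-bounded 1 w)) (toPerm-unique 1 w))
         (T-∧⁺ (≤⇒≤ᵇ (descents-++ (firstBlock-increasing 1 w) (secondBlock-increasing 1 w)))
               (T-not⁺ λ contains → <⇒≱ (toPerm-contains⇒ j 1 w contains) cf≤j))

  onto : ∀ π → T (isPermᵇ n π ∧ isGrassmannianᵇ π ∧ avoidsᵇ σ π) →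
         Σ (List Bool) λ w → IsWord n j w × toPerm 1 w ≡ π
  onto π t with T-∧⁻ {isPermᵇ n π} t
  ... | perm , grassmannian-avoids with isPermᵇ⇒ n π perm | T-∧⁻ {isGrassmannianᵇ π} grassmannian-avoids
  ... | |π|≡n , bounded , distinct | grassmannian , avoids
    with toPerm-onto n π |π|≡n bounded distinct (≤ᵇ⇒≤ _ _ grassmannian)
  ... | w , (c , |w|≡n) , refl = w , (c , |w|≡n , ≮⇒≥ (T-not⁻ avoids ∘ toPerm-contains⇐ j 1 w)) , refl

-- The argument works for every k ≥ 2 and every n.
mainTheorem8 : (k n : ℕ) → 3 ≤ k → 1 ≤ n → 𝒢 n (pat k) ↔ GDyck n (k ∸ 2)
mainTheorem8 (suc (suc j)) n _ _ = ↔-trans (↔-sym (Words↔𝒢 n j)) (Words↔GDyck n j)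
mainTheorem8 (suc zero)    _ (s≤s ()) _
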